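{- Let $\mathcal B$ be a resolvable $t$-$(v,k,\lambda)$ design with $r$ parallel classes, each consisting of $v/k$ blocks, and let $D$ be its $v\times b$ incidence matrix with the columns arranged by parallel classes (so $D$ consists of $r$ consecutive $v\times \frac{v}{k}$ column blocks, each containing the blocks of one parallel class). Let $L$ be a latin square of order $v/k$ with entries $l_1,\dots,l_{v/k}$ (distinct nonzero numbers). Then the matrix $M := D\,(I_r\otimes L)$ is a $\frac{v}{k}$-mosaic; that is, $M$ has all its entries in $\{l_1,\dots,l_{v/k}\}$ and for each $i$ the $0/1$ matrix $M_i$ with $[M_i]_{pj}=1$ iff $m_{pj}=l_i$ is the incidence matrix of a $t$-$(v,k,\lambda)$ design, giving $$t\text{ - }(v,v,b)=\bigoplus_{i=1}^{v/k} t\text{ - }(v,k,\lambda).$$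
   Context: A $t$-$(v,k,\lambda)$ design is a collection of $b$ $k$-element subsets (blocks) of a $v$-element point set $X$ such that every $t$-subset of $X$ lies in exactly $\lambda$ blocks; its incidence matrix is the $v\times b$ $0/1$ matrix with entry $1$ iff the point lies in the block. The design is resolvable if its blocks can be partitioned into parallel classes, each parallel class being a partition of $X$. $I_r$ is the $r\times r$ identity matrix and $\otimes$ the Kronecker product. For a positive integer $c$ and designs $\mathcal B_1,\dots,\mathcal B_c$ with the same number $v$ of points and $b$ of blocks, a $c$-mosaic of them is a $v\times b$ matrix $M=[m_{pj}]$ with entries in a set of $c$ distinct symbols $\{l_1,\dots,l_c\}$ such that for each $i$ the matrix $M_i$ with $[M_i]_{pj}=1$ if $m_{pj}=l_i$ and $0$ otherwise is an incidence matrix of $\mathcal B_i$.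
   Formalization: The distinct nonzero symbols $l_1,\dots,l_{v/k}$ are rational numbers, so the latin square L and the mosaic M have entries in ℚ. -}

module Defs where

open import Data.Nat using (ℕ; zero; suc; _≡ᵇ_) renaming (_+_ to _+ℕ_; _*_ to _*ℕ_)
open import Data.Integer using (+_)
open import Data.Rational using (ℚ; 0ℚ; 1ℚ; _/_; _≟_) renaming (_+_ to _+ℚ_; _*_ to _*ℚ_)
open import Data.Fin using (Fin; zero; suc; remQuot; combine) renaming (_≟_ to _≟F_)
open import Data.Fin.Subset using (Subset; _⊆_; ∣_∣)
open import Data.Fin.Subset.Properties using (_⊆?_)
open import Data.Vec using (tabulate)
open import Data.Bool using (if_then_else_)
open import Data.Product using (Σ; _×_; _,_)
open import Data.Sum using (_⊎_)
open import Relation.Nullary using (¬_)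
open import Relation.Nullary.Decidable using (⌊_⌋)
open import Relation.Binary.PropositionalEquality using (_≡_)

∑ℕ : (n : ℕ) → (Fin n → ℕ) → ℕ
∑ℕ zero    f = 0
∑ℕ (suc n) f = f zero +ℕ ∑ℕ n (λ i → f (suc i))

∑ℚ : (n : ℕ) → (Fin n → ℚ) → ℚ
∑ℚ zero    f = 0ℚ
∑ℚ (suc n) f = f zero +ℚ ∑ℚ n (λ i → f (suc i))

Matrix : Set → ℕ → ℕ → Set
Matrix A m n = Fin m → Fin n → A

_·_ : ∀ {m n p} → Matrix ℚ m n → Matrix ℚ n p → Matrix ℚ m p
(A · B) i j = ∑ℚ _ (λ s → A i s *ℚ B s j)

I : (r : ℕ) → Matrix ℚ r r
I r i j = if ⌊ i ≟F j ⌋ then 1ℚ else 0ℚ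

-- Kronecker product: row index combine i k ↦ (i,k), column index combine j l ↦ (j,l);
-- (A ⊗ B) (combine i k) (combine j l) = A i j * B k l.
_⊗_ : ∀ {m₁ n₁ m₂ n₂} → Matrix ℚ m₁ n₁ → Matrix ℚ m₂ n₂ → Matrix ℚ (m₁ *ℕ m₂) (n₁ *ℕ n₂)
(_⊗_ {m₁} {n₁} {m₂} {n₂} A B) x y with remQuot {m₁} m₂ x | remQuot {n₁} n₂ y
... | i , k | j , l = A i j *ℚ B k l

toℚMat : ∀ {m n} → Matrix ℕ m n → Matrix ℚ m n
toℚMat N i j = (+ N i j) / 1

column : ∀ {v b} → Matrix ℕ v b → Fin b → Subset v
column N j = tabulate (λ p → N p j ≡ᵇ 1)

blocksContaining : ∀ {v b} → Matrix ℕ v b → Subset v → ℕ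
blocksContaining {v} {b} N T = ∑ℕ b (λ j → if ⌊ T ⊆? column N j ⌋ then 1 else 0)

IsDesignIncidence : (t v k lam b : ℕ) → Matrix ℕ v b → Set
IsDesignIncidence t v k lam b N =
  (∀ p j → N p j ≡ 0 ⊎ N p j ≡ 1)
  × (∀ j → ∑ℕ v (λ p → N p j) ≡ k)
  × (∀ (T : Subset v) → ∣ T ∣ ≡ t → blocksContaining N T ≡ lam)

-- Columns of N (with b = r * n) are arranged by parallel classes: the
-- column block c (columns combine c j, j : Fin n) is a parallel class,
-- i.e. every point lies in exactly one of its blocks.
ArrangedByParallelClasses : (v r n : ℕ) → Matrix ℕ v (r *ℕ n) → Set
ArrangedByParallelClasses v r n N =
  ∀ (c : Fin r) (p : Fin v) →
    Σ (Fin n) (λ j → N p (combine c j) ≡ 1 × (∀ j' → N p (combine c j') ≡ 1 → j' ≡ j))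

IsLatinSquare : (n : ℕ) → (Fin n → ℚ) → Matrix ℚ n n → Set
IsLatinSquare n l L =
  (∀ a j → Σ (Fin n) (λ i → L a j ≡ l i))
  × (∀ a i → Σ (Fin n) (λ j → L a j ≡ l i × (∀ j' → L a j' ≡ l i → j' ≡ j)))
  × (∀ j i → Σ (Fin n) (λ a → L a j ≡ l i × (∀ a' → L a' j ≡ l i → a' ≡ a)))

symbolMatrix : ∀ {v b} → Matrix ℚ v b → ℚ → Matrix ℕ v b
symbolMatrix M x p j = if ⌊ M p j ≟ x ⌋ then 1 else 0

IsMosaic : ∀ {v b} (c : ℕ) (l : Fin c → ℚ) (IsB : Fin c → Matrix ℕ v b → Set) → Matrix ℚ v b → Set
IsMosaic c l IsB M =
  (∀ i i' → l i ≡ l i' → i ≡ i')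
  × (∀ p j → Σ (Fin c) (λ i → M p j ≡ l i))
  × (∀ i → IsB i (symbolMatrix M (l i)))

module Submission where

-- Writing the column index of D as a pair (c , a)
-- (class c, block a within it), the product M = D (I_r ⊗ L) has entries
--     M p (c , j) = L (a_c(p)) j,
-- where a_c(p) is the unique block of class c through the point p.  Since
-- column j of L contains the symbol lᵢ in exactly one row σᵢ(j), and σᵢ is
-- a permutation (its inverse reads off the column of lᵢ in a given row),
--     [Mᵢ] p (c , j) = 1  ⇔  a_c(p) = σᵢ(j)  ⇔  D p (c , σᵢ(j)) = 1.
-- So every Mᵢ is D with its columns permuted, blockwise by σᵢ, and being a
-- t-(v,k,λ) incidence matrix is invariant under column permutations.

open import Defs
open import Data.Nat using (ℕ; zero; suc; _*_; _≡ᵇ_) renaming (_+_ to _+ℕ_)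
import Data.Nat.Properties as ℕ
open import Data.Integer using (+_)
open import Data.Rational using (ℚ; 0ℚ; 1ℚ; _/_; _≟_) renaming (_+_ to _+ℚ_; _*_ to _*ℚ_)
import Data.Rational.Properties as ℚ
open import Data.Fin using (Fin; zero; suc; remQuot; combine) renaming (_≟_ to _≟F_)
open import Data.Fin.Properties using (suc-injective; remQuot-combine; combine-remQuot)
open import Data.Fin.Subset using (Subset; ∣_∣)
open import Data.Fin.Subset.Properties using (_⊆?_)
open import Data.Fin.Permutation using (Permutation′; permutation; _⟨$⟩ʳ_; _⟨$⟩ˡ_; inverseˡ; inverseʳ)
open import Data.Vec.Properties using (tabulate-cong)
open import Data.Bool using (if_then_else_)
open import Data.Product using (Σ; _,_; proj₁; proj₂; uncurry)
open import Data.Sum using (_⊎_; inj₁; inj₂)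
open import Function using (_∘_)
open import Relation.Nullary using (¬_; Dec; yes; no; contradiction)
open import Relation.Nullary.Decidable using (⌊_⌋)
open import Relation.Binary.PropositionalEquality
  using (_≡_; refl; sym; trans; cong; cong₂; subst; module ≡-Reasoning)
import Algebra.Properties.CommutativeMonoid.Sum as MonoidSum

open ≡-Reasoning

module ℕSum = MonoidSum ℕ.+-0-commutativeMonoid

∑ℕ≡sum : ∀ m (f : Fin m → ℕ) → ∑ℕ m f ≡ ℕSum.sum f
∑ℕ≡sum zero    f = refl
∑ℕ≡sum (suc m) f = cong (f zero +ℕ_) (∑ℕ≡sum m (f ∘ suc))

∑ℕ-cong : ∀ m {f g : Fin m → ℕ} → (∀ i → f i ≡ g i) → ∑ℕ m f ≡ ∑ℕ m g
∑ℕ-cong zero    f≡g = refl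
∑ℕ-cong (suc m) f≡g = cong₂ _+ℕ_ (f≡g zero) (∑ℕ-cong m (f≡g ∘ suc))

∑ℕ-permute : ∀ m (f : Fin m → ℕ) (π : Permutation′ m) → ∑ℕ m (f ∘ (π ⟨$⟩ʳ_)) ≡ ∑ℕ m f
∑ℕ-permute m f π = begin
  ∑ℕ m (f ∘ (π ⟨$⟩ʳ_))   ≡⟨ ∑ℕ≡sum m _ ⟩
  ℕSum.sum (f ∘ (π ⟨$⟩ʳ_)) ≡⟨ ℕSum.sum-permute f π ⟨
  ℕSum.sum f              ≡⟨ ∑ℕ≡sum m f ⟨
  ∑ℕ m f                  ∎

∑ℚ-zero : ∀ m (f : Fin m → ℚ) → (∀ x → f x ≡ 0ℚ) → ∑ℚ m f ≡ 0ℚ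
∑ℚ-zero zero    f f≡0 = refl
∑ℚ-zero (suc m) f f≡0 = cong₂ _+ℚ_ (f≡0 zero) (∑ℚ-zero m (f ∘ suc) (f≡0 ∘ suc))

∑ℚ-single : ∀ m (f : Fin m → ℚ) (x₀ : Fin m) →
            (∀ x → ¬ x ≡ x₀ → f x ≡ 0ℚ) → ∑ℚ m f ≡ f x₀
∑ℚ-single (suc m) f zero f≡0 = begin
  f zero +ℚ ∑ℚ m (f ∘ suc) ≡⟨ cong (f zero +ℚ_) (∑ℚ-zero m (f ∘ suc) (λ x → f≡0 (suc x) λ ())) ⟩
  f zero +ℚ 0ℚ             ≡⟨ ℚ.+-identityʳ (f zero) ⟩
  f zero                   ∎
∑ℚ-single (suc m) f (suc x₀) f≡0 = begin
  f zero +ℚ ∑ℚ m (f ∘ suc) ≡⟨ cong (_+ℚ ∑ℚ m (f ∘ suc)) (f≡0 zero λ ()) ⟩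
  0ℚ +ℚ ∑ℚ m (f ∘ suc)     ≡⟨ ℚ.+-identityˡ _ ⟩
  ∑ℚ m (f ∘ suc)           ≡⟨ ∑ℚ-single m (f ∘ suc) x₀ (λ x x≢x₀ → f≡0 (suc x) (x≢x₀ ∘ suc-injective)) ⟩
  f (suc x₀)               ∎

design-permuteColumns : ∀ {t v k lam b} (N N' : Matrix ℕ v b) (π : Permutation′ b) →
  (∀ p y → N' p y ≡ N p (π ⟨$⟩ʳ y)) →
  IsDesignIncidence t v k lam b N → IsDesignIncidence t v k lam b N'
design-permuteColumns {t} {v} {k} {lam} {b} N N' π N'≡Nπ (zeroOne , blockSize , tCover) =
  zeroOne' , blockSize' , tCover'
  where
  zeroOne' : ∀ p y → N' p y ≡ 0 ⊎ N' p y ≡ 1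
  zeroOne' p y = subst (λ e → e ≡ 0 ⊎ e ≡ 1) (sym (N'≡Nπ p y)) (zeroOne p (π ⟨$⟩ʳ y))

  blockSize' : ∀ y → ∑ℕ v (λ p → N' p y) ≡ k
  blockSize' y = trans (∑ℕ-cong v (λ p → N'≡Nπ p y)) (blockSize (π ⟨$⟩ʳ y))

  contains : Subset v → Matrix ℕ v b → Fin b → ℕ
  contains T M y = if ⌊ T ⊆? column M y ⌋ then 1 else 0

  tCover' : ∀ T → ∣ T ∣ ≡ t → blocksContaining N' T ≡ lam
  tCover' T ∣T∣≡t = begin
    blocksContaining N' T                   ≡⟨ ∑ℕ-cong b columnN'≡columnNπ ⟩
    ∑ℕ b (contains T N ∘ (π ⟨$⟩ʳ_))         ≡⟨ ∑ℕ-permute b (contains T N) π ⟩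
    blocksContaining N T                    ≡⟨ tCover T ∣T∣≡t ⟩
    lam                                     ∎
    where
    columnN'≡columnNπ : ∀ y → contains T N' y ≡ contains T N (π ⟨$⟩ʳ y)
    columnN'≡columnNπ y =
      cong (λ s → if ⌊ T ⊆? s ⌋ then 1 else 0)
           (tabulate-cong (λ p → cong (_≡ᵇ 1) (N'≡Nπ p y)))

combine-elim : ∀ {r n} (P : Fin (r * n) → Set) →
               (∀ c j → P (combine c j)) → ∀ y → P y
combine-elim {r} {n} P onCombine y =
  subst P (combine-remQuot {r} n y) (uncurry onCombine (remQuot {r} n y))

⊗-entry : ∀ {m₁ n₁ m₂ n₂} (A : Matrix ℚ m₁ n₁) (B : Matrix ℚ m₂ n₂) x y →
  (A ⊗ B) x y ≡ A (proj₁ (remQuot {m₁} m₂ x)) (proj₁ (remQuot {n₁} n₂ y))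
                *ℚ B (proj₂ (remQuot {m₁} m₂ x)) (proj₂ (remQuot {n₁} n₂ y))
⊗-entry {m₁} {n₁} {m₂} {n₂} A B x y with remQuot {m₁} m₂ x | remQuot {n₁} n₂ y
... | i , k | j , l = refl

⊗-combine : ∀ {m₁ n₁ m₂ n₂} (A : Matrix ℚ m₁ n₁) (B : Matrix ℚ m₂ n₂) i k j l →
            (A ⊗ B) (combine i k) (combine j l) ≡ A i j *ℚ B k l
⊗-combine {m₁} {n₁} {m₂} {n₂} A B i k j l =
  trans (⊗-entry A B (combine i k) (combine j l))
        (cong₂ (λ u w → A (proj₁ u) (proj₁ w) *ℚ B (proj₂ u) (proj₂ w))
               (remQuot-combine {m₁} {m₂} i k) (remQuot-combine {n₁} {n₂} j l))

I-diag : ∀ r (c : Fin r) → I r c c ≡ 1ℚ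
I-diag r c with c ≟F c
... | yes _   = refl
... | no c≢c = contradiction refl c≢c

I-offDiag : ∀ r (c c' : Fin r) → ¬ c ≡ c' → I r c c' ≡ 0ℚ
I-offDiag r c c' c≢c' with c ≟F c'
... | yes c≡c' = contradiction c≡c' c≢c'
... | no _     = refl

blockDiagonal-select : ∀ {v r n} (N : Matrix ℕ v (r * n)) (B : Matrix ℚ n n) p c a →
  (∀ x → N p x ≡ 0 ⊎ N p x ≡ 1) →
  N p (combine c a) ≡ 1 → (∀ a' → N p (combine c a') ≡ 1 → a' ≡ a) →
  ∀ j → (toℚMat N · (I r ⊗ B)) p (combine c j) ≡ B a j
blockDiagonal-select {v} {r} {n} N B p c a zeroOne hit unique j = begin
  ∑ℚ (r * n) term                   ≡⟨ ∑ℚ-single (r * n) term (combine c a) vanishes ⟩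
  toℚMat N p (combine c a) *ℚ weight (combine c a)
                                    ≡⟨ cong (λ e → ((+ e) / 1) *ℚ weight (combine c a)) hit ⟩
  1ℚ *ℚ weight (combine c a)        ≡⟨ ℚ.*-identityˡ (weight (combine c a)) ⟩
  weight (combine c a)              ≡⟨ ⊗-combine (I r) B c a c j ⟩
  I r c c *ℚ B a j                  ≡⟨ cong (_*ℚ B a j) (I-diag r c) ⟩
  1ℚ *ℚ B a j                       ≡⟨ ℚ.*-identityˡ (B a j) ⟩
  B a j                             ∎
  where
  weight term : Fin (r * n) → ℚ
  weight x = (I r ⊗ B) x (combine c j)
  term x = toℚMat N p x *ℚ weight x

  -- A term survives only if it lies in class c (else I_r kills it) and
  -- N p x = 1 (else N kills it), which forces x = combine c a.
  vanishesOnCombine : ∀ c' a' → ¬ combine c' a' ≡ combine c a → term (combine c' a') ≡ 0ℚ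
  vanishesOnCombine c' a' x≢x₀ with zeroOne (combine c' a') | c' ≟F c
  ... | inj₁ N≡0 | _ = trans (cong (λ e → ((+ e) / 1) *ℚ weight (combine c' a')) N≡0)
                             (ℚ.*-zeroˡ (weight (combine c' a')))
  ... | inj₂ N≡1 | yes refl = contradiction (cong (combine c) (unique a' N≡1)) x≢x₀
  ... | inj₂ _   | no c'≢c = begin
    Nx *ℚ weight (combine c' a') ≡⟨ cong (Nx *ℚ_) (⊗-combine (I r) B c' a' c j) ⟩
    Nx *ℚ (I r c' c *ℚ B a' j)   ≡⟨ cong (λ e → Nx *ℚ (e *ℚ B a' j)) (I-offDiag r c' c c'≢c) ⟩
    Nx *ℚ (0ℚ *ℚ B a' j)         ≡⟨ cong (Nx *ℚ_) (ℚ.*-zeroˡ (B a' j)) ⟩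
    Nx *ℚ 0ℚ                     ≡⟨ ℚ.*-zeroʳ Nx ⟩
    0ℚ                           ∎
    where
    Nx : ℚ
    Nx = toℚMat N p (combine c' a')

  vanishes : ∀ x → ¬ x ≡ combine c a → term x ≡ 0ℚ
  vanishes = combine-elim (λ x → ¬ x ≡ combine c a → term x ≡ 0ℚ) vanishesOnCombine

blockAct : ∀ r {n} → (Fin n → Fin n) → Fin (r * n) → Fin (r * n)
blockAct r {n} f y = combine (proj₁ (remQuot {r} n y)) (f (proj₂ (remQuot {r} n y)))

blockAct-combine : ∀ r {n} (f : Fin n → Fin n) c j → blockAct r f (combine c j) ≡ combine c (f j)
blockAct-combine r {n} f c j = cong (λ u → combine (proj₁ u) (f (proj₂ u))) (remQuot-combine {r} {n} c j)

blockAct-cancel : ∀ r {n} (f g : Fin n → Fin n) → (∀ j → f (g j) ≡ j) →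
                  ∀ y → blockAct r f (blockAct r g y) ≡ y
blockAct-cancel r f g f∘g≡id = combine-elim _ λ c j → begin
  blockAct r f (blockAct r g (combine c j)) ≡⟨ cong (blockAct r f) (blockAct-combine r g c j) ⟩
  blockAct r f (combine c (g j))            ≡⟨ blockAct-combine r f c (g j) ⟩
  combine c (f (g j))                       ≡⟨ cong (combine c) (f∘g≡id j) ⟩
  combine c j                               ∎

blockwise : ∀ r {n} → Permutation′ n → Permutation′ (r * n)
blockwise r π = permutation (blockAct r (π ⟨$⟩ʳ_)) (blockAct r (π ⟨$⟩ˡ_))
  (blockAct-cancel r (π ⟨$⟩ʳ_) (π ⟨$⟩ˡ_) (λ _ → inverseʳ π))
  (blockAct-cancel r (π ⟨$⟩ˡ_) (π ⟨$⟩ʳ_) (λ _ → inverseˡ π))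

symbolRows : ∀ {n l L} → IsLatinSquare n l L → Fin n → Permutation′ n
symbolRows {n} {l} {L} (_ , inRow , inColumn) i = permutation rowOf columnOf rowOf∘columnOf columnOf∘rowOf
  where
  rowOf columnOf : Fin n → Fin n
  rowOf j    = proj₁ (inColumn j i)
  columnOf a = proj₁ (inRow a i)

  rowOf∘columnOf : ∀ a → rowOf (columnOf a) ≡ a
  rowOf∘columnOf a = sym (proj₂ (proj₂ (inColumn (columnOf a) i)) a (proj₁ (proj₂ (inRow a i))))

  columnOf∘rowOf : ∀ j → columnOf (rowOf j) ≡ j
  columnOf∘rowOf j = sym (proj₂ (proj₂ (inRow (rowOf j) i)) j (proj₁ (proj₂ (inColumn j i))))

symbolRows-hit : ∀ {n l L} (latin : IsLatinSquare n l L) i j → L (symbolRows latin i ⟨$⟩ʳ j) j ≡ l i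
symbolRows-hit (_ , _ , inColumn) i j = proj₁ (proj₂ (inColumn j i))

symbolRows-unique : ∀ {n l L} (latin : IsLatinSquare n l L) i j a → L a j ≡ l i → a ≡ symbolRows latin i ⟨$⟩ʳ j
symbolRows-unique (_ , _ , inColumn) i j a = proj₂ (proj₂ (inColumn j i)) a

blockThrough : ∀ {v r n} (D : Matrix ℕ v (r * n)) →
               ArrangedByParallelClasses v r n D → Fin r → Fin v → Fin n
blockThrough D classes c p = proj₁ (classes c p)

resolvableProduct-entry : ∀ {v r n} (D : Matrix ℕ v (r * n)) (L : Matrix ℚ n n) →
  (∀ p x → D p x ≡ 0 ⊎ D p x ≡ 1) → (classes : ArrangedByParallelClasses v r n D) →
  ∀ p c j → (toℚMat D · (I r ⊗ L)) p (combine c j) ≡ L (blockThrough D classes c p) j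
resolvableProduct-entry D L zeroOne classes p c =
  blockDiagonal-select D L p c (blockThrough D classes c p) (zeroOne p)
    (proj₁ (proj₂ (classes c p))) (proj₂ (proj₂ (classes c p)))

resolvableProduct-symbol : ∀ {v r n} (D : Matrix ℕ v (r * n)) {l} {L : Matrix ℚ n n} →
  (∀ p x → D p x ≡ 0 ⊎ D p x ≡ 1) → (classes : ArrangedByParallelClasses v r n D) →
  (latin : IsLatinSquare n l L) →
  ∀ i p y → symbolMatrix (toℚMat D · (I r ⊗ L)) (l i) p y
            ≡ D p (blockwise r (symbolRows latin i) ⟨$⟩ʳ y)
resolvableProduct-symbol {r = r} D {l} {L} zeroOne classes latin i p =
  combine-elim _ onCombine
  where
  σ : Permutation′ _
  σ = symbolRows latin i

  onCombine : ∀ c j → symbolMatrix (toℚMat D · (I r ⊗ L)) (l i) p (combine c j)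
                      ≡ D p (blockwise r σ ⟨$⟩ʳ combine c j)
  onCombine c j = begin
    symbolMatrix (toℚMat D · (I r ⊗ L)) (l i) p (combine c j)
      ≡⟨ cong (λ q → if ⌊ q ≟ l i ⌋ then 1 else 0) (resolvableProduct-entry D L zeroOne classes p c j) ⟩
    (if ⌊ L a j ≟ l i ⌋ then 1 else 0)
      ≡⟨ decide (L a j ≟ l i) ⟩
    D p (combine c (σ ⟨$⟩ʳ j))
      ≡⟨ cong (D p) (blockAct-combine r (σ ⟨$⟩ʳ_) c j) ⟨
    D p (blockwise r σ ⟨$⟩ʳ combine c j) ∎
    where
    a : Fin _
    a = blockThrough D classes c p

    unique : ∀ a' → D p (combine c a') ≡ 1 → a' ≡ a
    unique = proj₂ (proj₂ (classes c p))

    -- L a j = lᵢ iff a = σ j iff D p (c , σ j) = 1, as a is the only block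
    -- of class c through p.
    decide : (d : Dec (L a j ≡ l i)) → (if ⌊ d ⌋ then 1 else 0) ≡ D p (combine c (σ ⟨$⟩ʳ j))
    decide (yes Laj≡li) = sym (subst (λ b → D p (combine c b) ≡ 1)
                                (symbolRows-unique latin i j a Laj≡li) (proj₁ (proj₂ (classes c p))))
    decide (no Laj≢li) with zeroOne p (combine c (σ ⟨$⟩ʳ j))
    ... | inj₁ D≡0 = sym D≡0
    ... | inj₂ D≡1 = contradiction (subst (λ b → L b j ≡ l i) (unique _ D≡1) (symbolRows-hit latin i j)) Laj≢li

mainTheorem2 : (t v k lam r n : ℕ) → v ≡ n * k
    → (D : Matrix ℕ v (r * n))
    → IsDesignIncidence t v k lam (r * n) D
    → ArrangedByParallelClasses v r n D
    → (l : Fin n → ℚ)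
    → (∀ i j → l i ≡ l j → i ≡ j)
    → (∀ i → ¬ (l i ≡ 0ℚ))
    → (L : Matrix ℚ n n)
    → IsLatinSquare n l L
    → IsMosaic n l (λ _ → IsDesignIncidence t v k lam (r * n)) (toℚMat D · (I r ⊗ L))
mainTheorem2 t v k lam r n _ D design classes l distinct _ L latin =
  distinct , entries , symbolDesigns
  where
  zeroOne : ∀ p x → D p x ≡ 0 ⊎ D p x ≡ 1
  zeroOne = proj₁ design

  entries : ∀ p y → Σ (Fin n) (λ i → (toℚMat D · (I r ⊗ L)) p y ≡ l i)
  entries p = combine-elim _ λ c j →
    let symbolAt = proj₁ latin (blockThrough D classes c p) j
    in proj₁ symbolAt , trans (resolvableProduct-entry D L zeroOne classes p c j) (proj₂ symbolAt)

  symbolDesigns : ∀ i → IsDesignIncidence t v k lam (r * n) (symbolMatrix (toℚMat D · (I r ⊗ L)) (l i))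
  symbolDesigns i = design-permuteColumns D _ (blockwise r (symbolRows latin i))
                      (resolvableProduct-symbol D zeroOne classes latin i) design
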